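{- For the complete bipartite graph $K_{m,n}$ with $1\le m\le n$ and $n\ne1$: $\operatorname{RSL}_{K_{m,n}}(1)=2$ if $m\ge2$; $\operatorname{RSL}_{K_{m,n}}(1)=3$ if $1=m<n$; and $\operatorname{RSL}_{K_{m,n}}(t)=t+2$ for $2\le t\le m+n-2$.
   Context: A linkage in a graph is a subgraph whose components are paths (a single vertex counts as a path); its order is its number of paths. For $\alpha,\beta\subseteq V(G)$, a linkage is an $(\alpha,\beta)$-linkage if $\alpha$ consists of one endpoint of each path and $\beta$ of the other endpoints (a one-vertex path has its vertex in both). If $s$ is the minimum number of vertices of an $(\alpha,\beta)$-linkage, an $(\alpha,\beta)$-rigid shortest linkage is an $(\alpha,\beta)$-linkage that is the unique one on $s$ vertices; a rigid shortest linkage is one that is $(\alpha,\beta)$-rigid shortest for some $\alpha,\beta$. $\operatorname{RSL}_G(t)$ is the maximum number of vertices in a rigid shortest linkage of order $t$ in $G$. -}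

module Defs where

open import Level using (0ℓ)
open import Data.Nat using (ℕ; _≤_)
open import Data.Fin using (Fin)
open import Data.Sum using (_⊎_; inj₁; inj₂)
open import Data.Product using (_×_; Σ; ∃; ∃-syntax)
open import Data.Empty using (⊥)
open import Data.Unit using (⊤)
open import Data.List using (List; []; _∷_; _++_; length; concat; map)
open import Data.List.NonEmpty using (List⁺; toList) renaming (head to head⁺; last to last⁺)
open import Data.List.Relation.Unary.All using (All)
open import Data.List.Relation.Unary.Any using (Any)
open import Data.List.Relation.Unary.Linked using (Linked)
open import Data.List.Relation.Unary.Unique.Propositional using (Unique)
open import Data.List.Membership.Propositional using (_∈_)
open import Relation.Binary.PropositionalEquality using (_≡_)
open import Function.Bundles using (_⇔_)

record Graph : Set₁ where
  field
    V   : Set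
    Adj : V → V → Set
open Graph public

KAdj : (m n : ℕ) → (Fin m ⊎ Fin n) → (Fin m ⊎ Fin n) → Set
KAdj m n (inj₁ _) (inj₁ _) = ⊥
KAdj m n (inj₁ _) (inj₂ _) = ⊤
KAdj m n (inj₂ _) (inj₁ _) = ⊤
KAdj m n (inj₂ _) (inj₂ _) = ⊥

K : ℕ → ℕ → Graph
K m n = record { V = Fin m ⊎ Fin n ; Adj = KAdj m n }

module _ (G : Graph) where

  -- A path is a nonempty vertex sequence with consecutive vertices adjacent
  -- (distinctness of its vertices is imposed in IsLinkage).
  -- A one-vertex path is allowed.
  Path : Set
  Path = List⁺ (V G)

  -- A linkage is given by its list of paths; the subgraph it denotes has as
  -- vertices all vertices on the paths and as edges the consecutive pairs.
  Linkage : Set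
  Linkage = List Path

  verts : Linkage → List (V G)
  verts L = concat (map toList L)

  -- all paths are walks in G and all vertices (within and across paths) are
  -- distinct: so the paths are vertex-disjoint paths, i.e. the components
  -- of the denoted subgraph are exactly these paths.
  IsLinkage : Linkage → Set
  IsLinkage L = All (λ p → Linked (Adj G) (toList p)) L × Unique (verts L)

  order : Linkage → ℕ
  order L = length L

  size : Linkage → ℕ
  size L = length (verts L)

  Consec : V G → V G → List (V G) → Set
  Consec u v p = ∃[ xs ] ∃[ ys ] (p ≡ xs ++ u ∷ v ∷ ys)

  VIn : Linkage → V G → Set
  VIn L v = v ∈ verts L

  EIn : Linkage → V G → V G → Set
  EIn L u v = Any (λ p → Consec u v (toList p) ⊎ Consec v u (toList p)) L

  SameSubgraph : Linkage → Linkage → Set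
  SameSubgraph L L' = (∀ v → VIn L v ⇔ VIn L' v) × (∀ u v → EIn L u v ⇔ EIn L' u v)

  IsABLinkage : (V G → Set) → (V G → Set) → Linkage → Set
  IsABLinkage α β L =
    IsLinkage L
    × (∀ v → α v ⇔ Any (λ p → head⁺ p ≡ v) L)
    × (∀ v → β v ⇔ Any (λ p → last⁺ p ≡ v) L)

  IsABRigidShortest : (V G → Set) → (V G → Set) → Linkage → Set
  IsABRigidShortest α β L =
    IsABLinkage α β L
    × (∀ L' → IsABLinkage α β L' → size L ≤ size L')
    × (∀ L' → IsABLinkage α β L' → size L' ≡ size L → SameSubgraph L L')

  IsRigidShortest : Linkage → Set₁
  IsRigidShortest L = Σ (V G → Set) λ α → Σ (V G → Set) λ β → IsABRigidShortest α β L

  RSL≡ : ℕ → ℕ → Set₁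
  RSL≡ t k =
    (Σ Linkage λ L → IsRigidShortest L × order L ≡ t × size L ≡ k)
    × (∀ L → IsRigidShortest L → order L ≡ t → size L ≤ k)

-- Let L be a rigid shortest (α,β)-linkage of order t in K_{m,n}. A path v₀v₁v₂v₃… of L could be
-- shortcut along the edge v₀v₃, so every path has at most two edges. If the paths had at least
-- three edges in total, two of them could be rerouted between the same endpoint sets, giving an
-- (α,β)-linkage that is smaller, or equally large but through an edge joining the two paths; both
-- contradict rigidity. Hence |L| ≤ t + 2, and for t = 1 and m ≥ 2 even |L| ≤ 2, since the middle
-- vertex of a three-vertex path can be replaced by another vertex of its side.
-- Conversely, the edge a₁b₁, and the paths a₁b₁, b₂a₂ (or b₁cb₂ when m = 1) together with
-- one-vertex paths, are rigid shortest: a competitor must visit all their vertices and no others;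
-- each of its paths starts at a start vertex, never meets another one, and stops at the first end
-- vertex, and within these vertices this forces it to retrace a given path.

module Submission where

open import Defs
open import Data.Bool using (Bool; true; false)
import Data.Bool.Properties as Bool
open import Data.Bool.Properties using (¬-not)
open import Data.Empty using (⊥; ⊥-elim)
open import Data.Unit using (tt)
import Data.Fin as Fin
open import Data.Fin using (Fin; zero; suc; toℕ; _↑ʳ_)
open import Data.List using (List; []; _∷_; _++_; length; concat; map; take; allFin)
open import Data.List.Properties using (length-++; length-map; length-take; length-tabulate; map-++; concat-++)
open import Data.List.NonEmpty as List⁺ using (List⁺; _∷_; toList)
open import Data.List.Membership.Propositional using (_∈_; _∉_; find; lose)
open import Data.List.Membership.Propositional.Properties
  using (∈-++⁺ˡ; ∈-++⁺ʳ; ∈-++⁻; ∈-∃++; ∈-concat⁺′; ∈-map⁺; ∈-map⁻)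
open import Data.List.Relation.Binary.Subset.Propositional using (_⊆_)
open import Data.List.Relation.Binary.Subset.Propositional.Properties using (concatMap⁺; Any-resp-⊆)
open import Data.List.Relation.Binary.Permutation.Propositional
  using (_↭_; ↭-refl; ↭-prep; ↭-swap; ↭-sym; ↭-trans; ↭-reflexive)
open import Data.List.Relation.Binary.Permutation.Propositional.Properties
  using (shift; shifts; ++⁺ˡ; ++⁺ʳ; ↭-length; All-resp-↭; Any-resp-↭)
import Data.List.Relation.Binary.Permutation.Propositional as Perm
import Data.List.Relation.Binary.Permutation.Setoid.Properties as PermSetoid
import Data.List.Relation.Binary.Permutation.Propositional.Properties as PermP
open import Data.List.Relation.Unary.All as All using (All; []; _∷_)
import Data.List.Relation.Unary.All.Properties as AllP
import Data.List.Relation.Unary.Any.Properties as AnyP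
open import Data.List.Relation.Unary.Any as Any using (Any; here; there)
open import Data.List.Relation.Unary.Linked as Linked using (Linked; []; [-]; _∷_)
open import Data.List.Relation.Unary.Unique.Propositional using (Unique; []; _∷_)
open import Data.List.Relation.Unary.Unique.Propositional.Properties as UniqueP using (Unique[x∷xs]⇒x∉xs)
open import Data.List.Relation.Binary.Disjoint.Propositional using (Disjoint)
open import Data.Nat using (ℕ; zero; suc; _≤_; _<_; _+_; _∸_; z≤n; s≤s)
open import Data.Nat.Properties
  using (≤-trans; <-irrefl; ≤-refl; ≤-reflexive; ≤-pred; ≤⇒≯; ≰⇒>; n≤1+n; _≤?_; +-monoˡ-<; +-monoʳ-≤;
         +-identityʳ; +-assoc; +-comm; +-suc; m≤n⇒m⊓n≡m; +-commutativeSemigroup; module ≤-Reasoning)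
open import Data.Nat.ListAction using (sum)
open import Data.Nat.ListAction.Properties using (sum-↭)
open import Algebra.Properties.CommutativeSemigroup +-commutativeSemigroup using (x∙yz≈y∙xz)
open import Data.Product using (_×_; _,_; proj₁; proj₂; ∃₂; ∃-syntax; swap)
open import Data.Sum as Sum using (_⊎_; inj₁; inj₂)
import Data.Sum.Properties as SumP
open import Function using (id; _∘_; _⟨_⟩_)
open import Function.Bundles using (_⇔_; mk⇔; Equivalence)
open import Function.Properties.Equivalence using () renaming (refl to ⇔-refl; trans to ⇔-trans)
open import Relation.Binary.Definitions using (DecidableEquality)
open import Relation.Binary.PropositionalEquality
  using (_≡_; _≢_; refl; sym; trans; cong; cong₂; subst; subst₂; setoid; module ≡-Reasoning)
open import Relation.Nullary using (¬_; yes; no)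

module _ {A : Set} where

  last-∷ : ∀ x y (ys : List A) → List⁺.last (x ∷ y ∷ ys) ≡ List⁺.last (y ∷ ys)
  last-∷ x y ys with Data.List.initLast ys
  ... | []                 = refl
  ... | zs Data.List.∷ʳ′ z = refl

  last-skip : ∀ x ys z (zs : List A) → List⁺.last (x ∷ ys ++ z ∷ zs) ≡ List⁺.last (z ∷ zs)
  last-skip x []       z zs = last-∷ x z zs
  last-skip x (y ∷ ys) z zs = trans (last-∷ x y (ys ++ z ∷ zs)) (last-skip y ys z zs)

  last∈ : ∀ x (xs : List A) → List⁺.last (x ∷ xs) ∈ x ∷ xs
  last∈ x []       = here refl
  last∈ x (y ∷ ys) = subst (_∈ x ∷ y ∷ ys) (sym (last-∷ x y ys)) (there (last∈ y ys))

  Unique-resp-↭ : ∀ {xs ys : List A} → xs ↭ ys → Unique xs → Unique ys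
  Unique-resp-↭ σ = PermSetoid.Unique-resp-↭ (setoid A) (Perm.↭⇒↭ₛ σ)

  Unique-drop-mid : ∀ xs {y : A} {ys} → Unique (xs ++ y ∷ ys) → Unique (xs ++ ys)
  Unique-drop-mid xs {y} {ys} u with Unique-resp-↭ (shift y xs ys) u
  ... | _ ∷ u′ = u′

  ↭-transpose : ∀ xs (a : A) ys b zs → xs ++ a ∷ ys ++ b ∷ zs ↭ xs ++ b ∷ ys ++ a ∷ zs
  ↭-transpose xs a ys b zs = ++⁺ˡ xs
    (↭-trans (↭-prep a (shift b ys zs))
    (↭-trans (↭-swap a b ↭-refl)
             (↭-prep b (↭-sym (shift a ys zs)))))

  Unique-transpose : ∀ xs {a : A} ys {b zs} →
                     Unique (xs ++ a ∷ ys ++ b ∷ zs) → Unique (xs ++ b ∷ ys ++ a ∷ zs)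
  Unique-transpose xs ys = Unique-resp-↭ (↭-transpose xs _ ys _ _)

  pigeonhole : ∀ {xs ys : List A} → Unique xs → xs ⊆ ys → length xs ≤ length ys
  pigeonhole {[]}     _          _   = z≤n
  pigeonhole {x ∷ xs} (x∉xs ∷ u) sub with ∈-∃++ (sub (here refl))
  ... | us , vs , refl =
    subst (suc (length xs) ≤_) (sym (↭-length (shift x us vs))) (s≤s (pigeonhole u sub′))
    where
    sub′ : xs ⊆ us ++ vs
    sub′ w∈xs with Any-resp-↭ (shift x us vs) (sub (there w∈xs))
    ... | here w≡x  = ⊥-elim (All.lookup x∉xs w∈xs (sym w≡x))
    ... | there w∈  = w∈

  ⊆-length⇒⊇ : DecidableEquality A → ∀ {xs ys : List A} →
               Unique xs → xs ⊆ ys → length ys ≤ length xs → ys ⊆ xs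
  ⊆-length⇒⊇ _≟_ {xs} {ys} u sub le {y} y∈ys with Any.any? (y ≟_) xs
  ... | yes y∈xs = y∈xs
  ... | no  y∉xs = ⊥-elim (<-irrefl refl (≤-trans (pigeonhole (y∉xs′ ∷ u) sub″) le))
    where
    y∉xs′ : All (y ≢_) xs
    y∉xs′ = All.tabulate λ { x∈ refl → y∉xs x∈ }
    sub″ : y ∷ xs ⊆ ys
    sub″ (here refl) = y∈ys
    sub″ (there x∈)  = sub x∈

  ∈⇒↭ : ∀ {x : A} {xs} → x ∈ xs → ∃[ ys ] (xs ↭ x ∷ ys)
  ∈⇒↭ {x} x∈ with ∈-∃++ x∈
  ... | us , vs , refl = us ++ vs , shift x us vs

  pick : ∀ {P : A → Set} {xs} → Any P xs → ∃₂ λ x ys → P x × xs ↭ x ∷ ys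
  pick any with find any
  ... | x , x∈ , px = x , proj₁ (∈⇒↭ x∈) , px , proj₂ (∈⇒↭ x∈)

  data OnlyLast (P : A → Set) : List A → Set where
    [_] : ∀ {x} → P x → OnlyLast P (x ∷ [])
    _∷_ : ∀ {x xs} → ¬ P x → OnlyLast P xs → OnlyLast P (x ∷ xs)

  onlyLast : ∀ {P : A → Set} x xs → Unique (x ∷ xs) →
             (∀ {v} → v ∈ x ∷ xs → P v → List⁺.last (x ∷ xs) ≡ v) → P (List⁺.last (x ∷ xs)) →
             OnlyLast P (x ∷ xs)
  onlyLast x []       _        _     Plast = [ Plast ]
  onlyLast {P} x (y ∷ ys) (x∉ ∷ u) atEnd Plast = ¬Px ∷ onlyLast y ys u atEnd′ (subst P last≡ Plast)
    where
    last≡ : List⁺.last (x ∷ y ∷ ys) ≡ List⁺.last (y ∷ ys)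
    last≡ = last-∷ x y ys
    ¬Px : ¬ P x
    ¬Px Px = Unique[x∷xs]⇒x∉xs (x∉ ∷ u)
      (subst (_∈ y ∷ ys) (trans (sym last≡) (atEnd (here refl) Px)) (last∈ y ys))
    atEnd′ : ∀ {v} → v ∈ y ∷ ys → P v → List⁺.last (y ∷ ys) ≡ v
    atEnd′ v∈ Pv = trans (sym last≡) (atEnd (there v∈) Pv)

  module _ {_~_ _⇝_ : A → A → Set} {P Q : A → Set}
           (deterministic : ∀ {a b c} → a ~ b → P b → a ⇝ c → b ≡ c) where

    walk-determined : ∀ {x ys zs} → Linked _~_ (x ∷ ys) → All P ys → OnlyLast Q (x ∷ ys) →
                      Linked _⇝_ (x ∷ zs) → OnlyLast Q (x ∷ zs) → ys ≡ zs
    walk-determined {ys = []}    {[]}    _ _ _ _ _ = refl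
    walk-determined {ys = []}    {_ ∷ _} _ _ [ Qx ] _ (¬Qx ∷ _) = ⊥-elim (¬Qx Qx)
    walk-determined {ys = _ ∷ _} {[]}    _ _ (¬Qx ∷ _) _ [ Qx ] = ⊥-elim (¬Qx Qx)
    walk-determined {ys = y ∷ _} {z ∷ _} (x~y ∷ ~ys) (Py ∷ Pys) (_ ∷ Qys) (x⇝z ∷ ⇝zs) (_ ∷ Qzs)
      with deterministic x~y Py x⇝z
    ... | refl = cong (y ∷_) (walk-determined ~ys Pys Qys ⇝zs Qzs)

  Unique-++-disjoint : ∀ xs {ys : List A} {v} → Unique (xs ++ ys) → v ∈ xs → v ∉ ys
  Unique-++-disjoint (x ∷ xs) (x∉ ∷ _) (here refl) v∈ys = All.lookup x∉ (∈-++⁺ʳ xs v∈ys) refl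
  Unique-++-disjoint (x ∷ xs) (_ ∷ u)  (there v∈) v∈ys  = Unique-++-disjoint xs u v∈ v∈ys

  Unique-++⁻ˡ : ∀ xs {ys : List A} → Unique (xs ++ ys) → Unique xs
  Unique-++⁻ˡ []       _          = []
  Unique-++⁻ˡ (x ∷ xs) (x∉ ∷ u) = AllP.++⁻ˡ xs x∉ ∷ Unique-++⁻ˡ xs u

≢∧≢⇒≡ : ∀ {x y z : Bool} → x ≢ z → y ≢ z → x ≡ y
≢∧≢⇒≡ x≢z y≢z = trans (¬-not x≢z) (sym (¬-not y≢z))

positive-rest : ∀ a b → 3 ≤ a + b → a < 3 → 1 ≤ b
positive-rest a zero    3≤a+0 a<3 = ⊥-elim (≤⇒≯ (subst (3 ≤_) (+-identityʳ a) 3≤a+0) a<3)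
positive-rest a (suc b) _     _   = s≤s z≤n

module Linkages (G : Graph) where

  IsPath : Path G → Set
  IsPath p = Linked (Adj G) (toList p)

  Heads Lasts : Linkage G → V G → Set
  Heads L v = Any (λ p → List⁺.head p ≡ v) L
  Lasts L v = Any (λ p → List⁺.last p ≡ v) L

  verts-++ : ∀ A B → verts G (A ++ B) ≡ verts G A ++ verts G B
  verts-++ A B = trans (cong concat (map-++ toList A B)) (sym (concat-++ (map toList A) (map toList B)))

  size-++ : ∀ A B → size G (A ++ B) ≡ size G A + size G B
  size-++ A B = trans (cong length (verts-++ A B)) (length-++ (verts G A))

  verts-↭ : ∀ {L L'} → L ↭ L' → verts G L ↭ verts G L'
  verts-↭ Perm.refl          = ↭-refl
  verts-↭ (Perm.prep p σ)    = ++⁺ˡ (toList p) (verts-↭ σ)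
  verts-↭ (Perm.swap p q σ)  =
    ↭-trans (shifts (toList p) (toList q)) (++⁺ˡ (toList q) (++⁺ˡ (toList p) (verts-↭ σ)))
  verts-↭ (Perm.trans σ σ′)  = ↭-trans (verts-↭ σ) (verts-↭ σ′)

  size-↭ : ∀ {L L'} → L ↭ L' → size G L ≡ size G L'
  size-↭ σ = ↭-length (verts-↭ σ)

  pathLength : Path G → ℕ
  pathLength p = length (List⁺.tail p)

  totalLength : Linkage G → ℕ
  totalLength L = sum (map pathLength L)

  size≡order+totalLength : ∀ L → size G L ≡ length L + totalLength L
  size≡order+totalLength []              = refl
  size≡order+totalLength ((x ∷ xs) ∷ L) = cong suc (begin
    length (xs ++ verts G L)               ≡⟨ length-++ xs ⟩
    length xs + size G L                   ≡⟨ cong (length xs +_) (size≡order+totalLength L) ⟩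
    length xs + (length L + totalLength L) ≡⟨ x∙yz≈y∙xz (length xs) (length L) (totalLength L) ⟩
    length L + (length xs + totalLength L) ∎)
    where open ≡-Reasoning

  totalLength-↭ : ∀ {L p R} → L ↭ p ∷ R → totalLength L ≡ pathLength p + totalLength R
  totalLength-↭ σ = sum-↭ (PermP.map⁺ pathLength σ)

  totalLength-↭₂ : ∀ {L p q R R′} → L ↭ p ∷ R → R ↭ q ∷ R′ →
                   totalLength L ≡ pathLength p + pathLength q + totalLength R′
  totalLength-↭₂ {p = p} σ τ =
    trans (totalLength-↭ σ) (trans (cong (pathLength p +_) (totalLength-↭ τ)) (sym (+-assoc (pathLength p) _ _)))

  nonempty-path : ∀ {L} → 1 ≤ totalLength L → Any (λ p → 1 ≤ pathLength p) L
  nonempty-path {(_ ∷ []) ∷ _}    pos = there (nonempty-path pos)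
  nonempty-path {(_ ∷ _ ∷ _) ∷ _} _   = here (s≤s z≤n)

  ∈-verts⁺ : ∀ {L p v} → p ∈ L → v ∈ toList p → v ∈ verts G L
  ∈-verts⁺ p∈ v∈ = ∈-concat⁺′ v∈ (∈-map⁺ toList p∈)

  verts-mono : ∀ {L L'} → L ⊆ L' → verts G L ⊆ verts G L'
  verts-mono = concatMap⁺ toList

  EIn-sym : ∀ {L a b} → EIn G L a b → EIn G L b a
  EIn-sym = Any.map Sum.swap

  Consec⇒∈ : ∀ {u v l} → Consec G u v l → u ∈ l × v ∈ l
  Consec⇒∈ (xs , _ , refl) = ∈-++⁺ʳ xs (here refl) , ∈-++⁺ʳ xs (there (here refl))

  EIn⇒path : ∀ {L a b} → EIn G L a b → ∃[ p ] (p ∈ L × a ∈ toList p × b ∈ toList p)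
  EIn⇒path e with find e
  ... | p , p∈ , inj₁ ab = p , p∈ , Consec⇒∈ ab
  ... | p , p∈ , inj₂ ba = p , p∈ , swap (Consec⇒∈ ba)

  module _ {L : Linkage G} (unique : Unique (verts G L)) where

    path-unique : ∀ {p} → p ∈ L → Unique (toList p)
    path-unique {p} p∈ = Unique-++⁻ˡ (toList p) (Unique-resp-↭ (verts-↭ (proj₂ (∈⇒↭ p∈))) unique)

    same-path : ∀ {p q v} → p ∈ L → q ∈ L → v ∈ toList p → v ∈ toList q → p ≡ q
    same-path {p} p∈ q∈ v∈p v∈q with ∈⇒↭ p∈
    ... | R , σ with Any-resp-↭ σ q∈
    ... | here refl = refl
    ... | there q∈R =
      ⊥-elim (Unique-++-disjoint (toList p) (Unique-resp-↭ (verts-↭ σ) unique) v∈p (∈-verts⁺ q∈R v∈q))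

  Any-endpoint⇔ : ∀ (f : Path G → V G) {L L' v} → map f L' ↭ map f L →
                  Any (λ p → f p ≡ v) L ⇔ Any (λ p → f p ≡ v) L'
  Any-endpoint⇔ f {v = v} σ = mk⇔ (λ a → AnyP.map⁻ (Any-resp-↭ (↭-sym σ) (AnyP.map⁺ {P = _≡ v} a)))
                                  (λ a → AnyP.map⁻ (Any-resp-↭ σ (AnyP.map⁺ {P = _≡ v} a)))

  IsABLinkage-transfer : ∀ {α β L L'} → IsABLinkage G α β L → All IsPath L' → Unique (verts G L') →
                         map List⁺.head L' ↭ map List⁺.head L → map List⁺.last L' ↭ map List⁺.last L →
                         IsABLinkage G α β L'
  IsABLinkage-transfer (_ , α⇔ , β⇔) paths unique heads↭ lasts↭ =
    (paths , unique) ,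
    (λ v → ⇔-trans (α⇔ v) (Any-endpoint⇔ List⁺.head heads↭)) ,
    (λ v → ⇔-trans (β⇔ v) (Any-endpoint⇔ List⁺.last lasts↭))

  IsABLinkage-resp-↭ : ∀ {α β L L'} → L ↭ L' → IsABLinkage G α β L → IsABLinkage G α β L'
  IsABLinkage-resp-↭ σ ab@((paths , unique) , _) =
    IsABLinkage-transfer ab (All-resp-↭ σ paths) (Unique-resp-↭ (verts-↭ σ) unique)
                         (PermP.map⁺ _ (↭-sym σ)) (PermP.map⁺ _ (↭-sym σ))

  module _ {α β : V G → Set} {L : Linkage G} (ab : IsABLinkage G α β L) where

    private
      unique : Unique (verts G L)
      unique = proj₂ (proj₁ ab)

    α⇒head : ∀ {v} → α v → ∃[ p ] (p ∈ L × List⁺.head p ≡ v)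
    α⇒head αv = find (Equivalence.to (proj₁ (proj₂ ab) _) αv)

    β⇒last : ∀ {v} → β v → ∃[ p ] (p ∈ L × List⁺.last p ≡ v)
    β⇒last βv = find (Equivalence.to (proj₂ (proj₂ ab) _) βv)

    head-α : ∀ {p} → p ∈ L → α (List⁺.head p)
    head-α p∈ = Equivalence.from (proj₁ (proj₂ ab) _) (lose p∈ refl)

    last-β : ∀ {p} → p ∈ L → β (List⁺.last p)
    last-β p∈ = Equivalence.from (proj₂ (proj₂ ab) _) (lose p∈ refl)

    α⊆verts : ∀ {v} → α v → v ∈ verts G L
    α⊆verts αv with α⇒head αv
    ... | x ∷ _ , p∈ , refl = ∈-verts⁺ p∈ (here refl)

    β⊆verts : ∀ {v} → β v → v ∈ verts G L
    β⊆verts βv with β⇒last βv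
    ... | x ∷ xs , p∈ , refl = ∈-verts⁺ p∈ (last∈ x xs)

    α-only-at-head : ∀ {p} → p ∈ L → All (λ v → ¬ α v) (List⁺.tail p)
    α-only-at-head {x ∷ xs} p∈ = All.tabulate λ {y} y∈ αy → α-at-head y∈ (α⇒head αy)
      where
      α-at-head : ∀ {y} → y ∈ xs → ∃[ q ] (q ∈ L × List⁺.head q ≡ y) → ⊥
      α-at-head y∈ (y ∷ _ , q∈ , refl) with same-path unique p∈ q∈ (there y∈) (here refl)
      ... | refl = Unique[x∷xs]⇒x∉xs (path-unique unique p∈) y∈

    OnlyLast-β : ∀ {p} → p ∈ L → OnlyLast β (toList p)
    OnlyLast-β {x ∷ xs} p∈ = onlyLast x xs (path-unique unique p∈) β-at-end (last-β p∈)
      where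
      β-at-end : ∀ {v} → v ∈ x ∷ xs → β v → List⁺.last (x ∷ xs) ≡ v
      β-at-end v∈ βv with β⇒last βv
      ... | q , q∈ , refl with same-path unique p∈ q∈ v∈ (last∈ _ (List⁺.tail q))
      ... | refl = refl

  module _ {α β : V G → Set} {L : Linkage G} (rs : IsABRigidShortest G α β L) where

    no-better-replacement : ∀ {A R A'} → L ↭ A ++ R → All IsPath A' → Unique (verts G (A' ++ R)) →
      map List⁺.head A' ↭ map List⁺.head A → map List⁺.last A' ↭ map List⁺.last A →
      size G A' < size G A ⊎ (size G A' ≡ size G A × ∃₂ λ a b → EIn G A' a b × ¬ EIn G L a b) → ⊥
    no-better-replacement {A} {R} {A'} σ paths' unique' heads↭ lasts↭ = refute
      where
      ab : IsABLinkage G α β (A ++ R)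
      ab = IsABLinkage-resp-↭ σ (proj₁ rs)
      endpoints↭ : ∀ {f : Path G → V G} → map f A' ↭ map f A → map f (A' ++ R) ↭ map f (A ++ R)
      endpoints↭ {f} eσ = subst₂ _↭_ (sym (map-++ f A' R)) (sym (map-++ f A R)) (++⁺ʳ (map f R) eσ)
      ab' : IsABLinkage G α β (A' ++ R)
      ab' = IsABLinkage-transfer ab (AllP.++⁺ paths' (AllP.++⁻ʳ A (proj₁ (proj₁ ab)))) unique'
                                 (endpoints↭ heads↭) (endpoints↭ lasts↭)
      size-L : size G L ≡ size G A + size G R
      size-L = trans (size-↭ σ) (size-++ A R)
      refute : size G A' < size G A ⊎
               (size G A' ≡ size G A × ∃₂ λ a b → EIn G A' a b × ¬ EIn G L a b) → ⊥
      refute (inj₁ shorter) = <-irrefl refl (begin-strict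
        size G L              ≤⟨ proj₁ (proj₂ rs) _ ab' ⟩
        size G (A' ++ R)      ≡⟨ size-++ A' R ⟩
        size G A' + size G R  <⟨ +-monoˡ-< (size G R) shorter ⟩
        size G A + size G R   ≡⟨ size-L ⟨
        size G L              ∎)
        where open ≤-Reasoning
      refute (inj₂ (same , a , b , new , ¬old)) =
        ¬old (Equivalence.from (proj₂ (proj₂ (proj₂ rs) _ ab' size≡) a b) (AnyP.++⁺ˡ new))
        where
        size≡ : size G (A' ++ R) ≡ size G L
        size≡ = trans (size-++ A' R) (trans (cong (_+ size G R) same) (sym size-L))

  ForcedStep : Linkage G → V G → V G → Set
  ForcedStep L u v = ∀ {y} → y ∈ verts G L → Adj G u y → y ≡ v ⊎ Heads L y

  rigid-shortest-criterion : DecidableEquality (V G) → ∀ {L} → IsLinkage G L →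
    (∀ {L'} → IsABLinkage G (Heads L) (Lasts L) L' → verts G L ⊆ verts G L') →
    All (λ p → Linked (ForcedStep L) (toList p)) L →
    IsRigidShortest G L
  rigid-shortest-criterion _≟_ {L} isL covered forced = Heads L , Lasts L , abL , shortest , rigid
    where
    abL : IsABLinkage G (Heads L) (Lasts L) L
    abL = isL , (λ _ → ⇔-refl) , (λ _ → ⇔-refl)
    shortest : ∀ L' → IsABLinkage G (Heads L) (Lasts L) L' → size G L ≤ size G L'
    shortest L' ab' = pigeonhole (proj₂ isL) (covered ab')
    module _ {L'} (ab' : IsABLinkage G (Heads L) (Lasts L) L') (size≡ : size G L' ≡ size G L) where
      inside : verts G L' ⊆ verts G L
      inside = ⊆-length⇒⊇ _≟_ (proj₂ isL) (covered ab') (≤-reflexive size≡)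
      deterministic : ∀ {a b c} → Adj G a b → b ∈ verts G L × ¬ Heads L b → ForcedStep L a c → b ≡ c
      deterministic a~b (b∈ , ¬head) step = Sum.[ id , ⊥-elim ∘ ¬head ] (step b∈ a~b)
      retraces : ∀ {r p} → r ∈ L' → p ∈ L → List⁺.head r ≡ List⁺.head p → r ≡ p
      retraces {x ∷ ys} {.x ∷ zs} r∈ p∈ refl = cong (x ∷_)
        (walk-determined deterministic (All.lookup (proj₁ (proj₁ ab')) r∈)
          (All.zip (All.tabulate (λ y∈ → inside (∈-verts⁺ r∈ (there y∈))) , α-only-at-head ab' r∈))
          (OnlyLast-β ab' r∈) (All.lookup forced p∈) (OnlyLast-β abL p∈))
      L'⊆L : L' ⊆ L
      L'⊆L r∈ with α⇒head abL (head-α ab' r∈)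
      ... | p , p∈ , head≡ = subst (_∈ L) (sym (retraces r∈ p∈ (sym head≡))) p∈
      L⊆L' : L ⊆ L'
      L⊆L' p∈ with α⇒head ab' (head-α abL p∈)
      ... | r , r∈ , head≡ = subst (_∈ L') (retraces r∈ p∈ head≡) r∈
    rigid : ∀ L' → IsABLinkage G (Heads L) (Lasts L) L' → size G L' ≡ size G L → SameSubgraph G L L'
    rigid L' ab' size≡ =
      (λ _ → mk⇔ (verts-mono (L⊆L' ab' size≡)) (verts-mono (L'⊆L ab' size≡))) ,
      (λ _ _ → mk⇔ (Any-resp-⊆ (L⊆L' ab' size≡)) (Any-resp-⊆ (L'⊆L ab' size≡)))

  separated : ∀ {p q R a b} → Unique (verts G (p ∷ q ∷ R)) →
              a ∈ toList p → b ∈ toList q → ¬ EIn G (p ∷ q ∷ R) a b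
  separated u a∈p b∈q e with EIn⇒path e
  ... | s , s∈ , a∈s , b∈s with same-path u s∈ (here refl) a∈s a∈p
  ... | refl = Unique-++-disjoint (toList s) u b∈s (∈-++⁺ˡ b∈q)

  -- Only the endpoint sets are prescribed, so the new paths may join the start of p to the end of q.
  record Exchange (p q : Path G) : Set where
    field
      paths   : Linkage G
      isPaths : All IsPath paths
      heads↭  : map List⁺.head paths ↭ List⁺.head p ∷ List⁺.head q ∷ []
      lasts↭  : map List⁺.last paths ↭ List⁺.last p ∷ List⁺.last q ∷ []
      unique  : ∀ {R} → Unique (verts G (p ∷ q ∷ R)) → Unique (verts G (paths ++ R))
      better  : size G paths < size G (p ∷ q ∷ []) ⊎
                (size G paths ≡ size G (p ∷ q ∷ []) ×
                 ∃₂ λ a b → EIn G paths a b × a ∈ toList p × b ∈ toList q)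

  Exchange-sym : ∀ {p q} → Exchange p q → Exchange q p
  Exchange-sym {p} {q} ex = record
    { paths   = paths
    ; isPaths = isPaths
    ; heads↭  = ↭-trans heads↭ (↭-swap _ _ ↭-refl)
    ; lasts↭  = ↭-trans lasts↭ (↭-swap _ _ ↭-refl)
    ; unique  = λ u → unique (Unique-resp-↭ (shifts (toList q) (toList p)) u)
    ; better  = Sum.map (subst (size G paths <_) swapped)
                        (λ (same , a , b , e , a∈ , b∈) → trans same swapped , b , a , EIn-sym e , b∈ , a∈)
                        better
    }
    where
    open Exchange ex
    swapped : size G (p ∷ q ∷ []) ≡ size G (q ∷ p ∷ [])
    swapped = size-↭ (↭-swap p q (↭-refl {x = []}))

  module _ {α β : V G → Set} {L : Linkage G} (rs : IsABRigidShortest G α β L) where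

    no-exchange : ∀ {p q R} → L ↭ p ∷ q ∷ R → Exchange p q → ⊥
    no-exchange {p} {q} {R} σ ex =
      no-better-replacement rs {A = p ∷ q ∷ []} {R} σ isPaths (unique u) heads↭ lasts↭
        (Sum.map₂ (λ (same , a , b , e , a∈ , b∈) → same , a , b , e , separated u a∈ b∈ ∘ Any-resp-↭ σ)
                  better)
      where
      open Exchange ex
      u : Unique (verts G (p ∷ q ∷ R))
      u = Unique-resp-↭ (verts-↭ σ) (proj₂ (proj₁ (proj₁ rs)))

  singletons : List (V G) → Linkage G
  singletons S = map List⁺.[_] S

  verts-singletons : ∀ S → verts G (singletons S) ≡ S
  verts-singletons []      = refl
  verts-singletons (s ∷ S) = cong (s ∷_) (verts-singletons S)

  Heads-singletons : ∀ {S v} → v ∈ S → Heads (singletons S) v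
  Heads-singletons v∈S = AnyP.map⁺ (lose v∈S refl)

  Lasts-singletons : ∀ {S v} → Lasts (singletons S) v → v ∈ S
  Lasts-singletons lasts with find (AnyP.map⁻ lasts)
  ... | s , s∈S , refl = s∈S

  order-++-singletons : ∀ C S → order G (C ++ singletons S) ≡ length C + length S
  order-++-singletons C S = trans (length-++ C) (cong (length C +_) (length-map List⁺.[_] S))

  size-++-singletons : ∀ C S → size G (C ++ singletons S) ≡ size G C + length S
  size-++-singletons C S = trans (size-++ C (singletons S)) (cong (size G C +_) (cong length (verts-singletons S)))

  module _ {C : Linkage G} {S : List (V G)} where

    private
      L = C ++ singletons S

      verts-L : verts G L ≡ verts G C ++ S
      verts-L = trans (verts-++ C (singletons S)) (cong (verts G C ++_) (verts-singletons S))

      Heads-S : ∀ {v} → v ∈ S → Heads L v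
      Heads-S v∈S = AnyP.++⁺ʳ C (Heads-singletons v∈S)

    endpoints-covered : (∀ {v} → v ∈ verts G C → Heads C v ⊎ Lasts C v) →
                        ∀ {L'} → IsABLinkage G (Heads L) (Lasts L) L' → verts G C ⊆ verts G L'
    endpoints-covered endpoint ab' v∈C with endpoint v∈C
    ... | inj₁ head = α⊆verts ab' (AnyP.++⁺ˡ head)
    ... | inj₂ last = β⊆verts ab' (AnyP.++⁺ˡ last)

    rigid-shortest-with-singletons : DecidableEquality (V G) → IsLinkage G C → Unique S →
      Disjoint (verts G C) S →
      (∀ {L'} → IsABLinkage G (Heads L) (Lasts L) L' → verts G C ⊆ verts G L') →
      All (λ p → Linked (ForcedStep C) (toList p)) C →
      IsRigidShortest G L
    rigid-shortest-with-singletons _≟_ (C-paths , C-unique) S-unique disjoint covered forced =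
      rigid-shortest-criterion _≟_ isL covered-L (AllP.++⁺ (All.map (Linked.map lift) forced) singletons-forced)
      where
      isL : IsLinkage G L
      isL = AllP.++⁺ C-paths (AllP.map⁺ (All.universal (λ _ → [-]) S)) ,
            subst Unique (sym verts-L) (UniqueP.++⁺ C-unique S-unique disjoint)
      in-C-or-S : ∀ {v} → v ∈ verts G L → v ∈ verts G C ⊎ v ∈ S
      in-C-or-S v∈ = ∈-++⁻ (verts G C) (subst (_ ∈_) verts-L v∈)
      covered-L : ∀ {L'} → IsABLinkage G (Heads L) (Lasts L) L' → verts G L ⊆ verts G L'
      covered-L ab' v∈ with in-C-or-S v∈
      ... | inj₁ v∈C = covered ab' v∈C
      ... | inj₂ v∈S = α⊆verts ab' (Heads-S v∈S)
      lift : ∀ {u v} → ForcedStep C u v → ForcedStep L u v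
      lift step y∈ u~y with in-C-or-S y∈
      ... | inj₁ y∈C = Sum.map₂ AnyP.++⁺ˡ (step y∈C u~y)
      ... | inj₂ y∈S = inj₂ (Heads-S y∈S)
      singletons-forced : All (λ p → Linked (ForcedStep L) (toList p)) (singletons S)
      singletons-forced = AllP.map⁺ (All.universal (λ _ → [-]) S)

module CompleteBipartite (m n : ℕ) where

  open Linkages (K m n)

  Vertex : Set
  Vertex = Fin m ⊎ Fin n

  side : Vertex → Bool
  side (inj₁ _) = true
  side (inj₂ _) = false

  Adj⇒side≢ : ∀ {a b} → KAdj m n a b → side a ≢ side b
  Adj⇒side≢ {inj₁ _} {inj₂ _} _ ()
  Adj⇒side≢ {inj₂ _} {inj₁ _} _ ()

  side≢⇒Adj : ∀ {a b} → side a ≢ side b → KAdj m n a b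
  side≢⇒Adj {inj₁ _} {inj₁ _} ≢ = ⊥-elim (≢ refl)
  side≢⇒Adj {inj₁ _} {inj₂ _} _ = tt
  side≢⇒Adj {inj₂ _} {inj₁ _} _ = tt
  side≢⇒Adj {inj₂ _} {inj₂ _} ≢ = ⊥-elim (≢ refl)

  side≢⇒≢ : ∀ {a b} → side a ≢ side b → a ≢ b
  side≢⇒≢ ≢ refl = ≢ refl

  Adj-respˡ : ∀ {a a' b} → side a ≡ side a' → KAdj m n a b → KAdj m n a' b
  Adj-respˡ a≡a' ab = side≢⇒Adj (Adj⇒side≢ ab ∘ trans a≡a')

  Adj-respʳ : ∀ {a b b'} → side b ≡ side b' → KAdj m n a b → KAdj m n a b'
  Adj-respʳ b≡b' ab = side≢⇒Adj (λ a≡b' → Adj⇒side≢ ab (trans a≡b' (sym b≡b')))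

  Adj₂⇒side≡ : ∀ {a b c} → KAdj m n a b → KAdj m n b c → side a ≡ side c
  Adj₂⇒side≡ ab bc = ≢∧≢⇒≡ (Adj⇒side≢ ab) (Adj⇒side≢ bc ∘ sym)

  -- Two single edges starting on opposite sides are not exchangeable: each start vertex lies on
  -- the side of the other edge's end, so it cannot be joined to that end directly.
  Exchangeable : Path (K m n) → Path (K m n) → Set
  Exchangeable p q = 1 ≤ pathLength p × 1 ≤ pathLength q ×
                     (side (List⁺.head p) ≡ side (List⁺.head q) ⊎ 3 ≤ pathLength p + pathLength q)

  exchange₁₁ : ∀ {x y u w} → KAdj m n x y → KAdj m n u w → side x ≡ side u →
               Exchange (x ∷ y ∷ []) (u ∷ w ∷ [])
  exchange₁₁ {x} {y} {u} {w} xy uw x≡u = record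
    { paths   = (x ∷ w ∷ []) ∷ (u ∷ y ∷ []) ∷ []
    ; isPaths = (Adj-respˡ (sym x≡u) uw ∷ [-]) ∷ (Adj-respˡ x≡u xy ∷ [-]) ∷ []
    ; heads↭  = ↭-refl
    ; lasts↭  = ↭-swap _ _ ↭-refl
    ; unique  = Unique-transpose (x ∷ []) (u ∷ [])
    ; better  = inj₂ (refl , x , w , here (inj₁ ([] , [] , refl)) , here refl , there (here refl))
    }

  exchange₁₂ : ∀ {x y u z w} → KAdj m n x y → KAdj m n u z → KAdj m n z w →
               Exchange (x ∷ y ∷ []) (u ∷ z ∷ w ∷ [])
  exchange₁₂ {x} {y} {u} {z} {w} xy uz zw with side x Bool.≟ side u
  ... | yes x≡u = record
    { paths   = (u ∷ y ∷ []) ∷ (x ∷ z ∷ w ∷ []) ∷ []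
    ; isPaths = (Adj-respˡ x≡u xy ∷ [-]) ∷ (Adj-respˡ (sym x≡u) uz ∷ zw ∷ [-]) ∷ []
    ; heads↭  = ↭-swap _ _ ↭-refl
    ; lasts↭  = ↭-refl
    ; unique  = Unique-transpose [] (y ∷ [])
    ; better  = inj₂ (refl , x , z , there (here (inj₁ ([] , w ∷ [] , refl))) , here refl , there (here refl))
    }
  ... | no x≢u = record
    { paths   = (x ∷ w ∷ []) ∷ (u ∷ z ∷ y ∷ []) ∷ []
    ; isPaths = (Adj-respʳ (Adj₂⇒side≡ uz zw) (side≢⇒Adj x≢u) ∷ [-])
              ∷ (uz ∷ Adj-respˡ (≢∧≢⇒≡ x≢u (Adj⇒side≢ uz ∘ sym)) xy ∷ [-]) ∷ []
    ; heads↭  = ↭-refl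
    ; lasts↭  = ↭-swap _ _ ↭-refl
    ; unique  = Unique-transpose (x ∷ []) (u ∷ z ∷ [])
    ; better  = inj₂ (refl , x , w , here (inj₁ ([] , [] , refl)) , here refl , there (there (here refl)))
    }

  exchange₂₂ : ∀ {x y z u v w} → KAdj m n x y → KAdj m n y z → KAdj m n u v → KAdj m n v w →
               Exchange (x ∷ y ∷ z ∷ []) (u ∷ v ∷ w ∷ [])
  exchange₂₂ {x} {y} {z} {u} {v} {w} xy yz uv vw with side x Bool.≟ side u
  ... | yes x≡u = record
    { paths   = (x ∷ y ∷ w ∷ []) ∷ (u ∷ v ∷ z ∷ []) ∷ []
    ; isPaths = (xy ∷ Adj-respʳ z≡w yz ∷ [-]) ∷ (uv ∷ Adj-respʳ (sym z≡w) vw ∷ [-]) ∷ []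
    ; heads↭  = ↭-refl
    ; lasts↭  = ↭-swap _ _ ↭-refl
    ; unique  = Unique-transpose (x ∷ y ∷ []) (u ∷ v ∷ [])
    ; better  = inj₂ (refl , y , w , here (inj₁ (x ∷ [] , [] , refl)) ,
                      there (here refl) , there (there (here refl)))
    }
    where
    z≡w : side z ≡ side w
    z≡w = trans (sym (Adj₂⇒side≡ xy yz)) (trans x≡u (Adj₂⇒side≡ uv vw))
  ... | no x≢u = record
    { paths   = (x ∷ w ∷ []) ∷ (u ∷ z ∷ []) ∷ []
    ; isPaths = (Adj-respʳ (Adj₂⇒side≡ uv vw) (side≢⇒Adj x≢u) ∷ [-])
              ∷ (Adj-respʳ (Adj₂⇒side≡ xy yz) (side≢⇒Adj (x≢u ∘ sym)) ∷ [-]) ∷ []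
    ; heads↭  = ↭-refl
    ; lasts↭  = ↭-swap _ _ ↭-refl
    ; unique  = Unique-transpose (x ∷ []) (u ∷ [])
              ∘ Unique-drop-mid (x ∷ z ∷ u ∷ []) ∘ Unique-drop-mid (x ∷ [])
    ; better  = inj₁ (n≤1+n 5)
    }

  exchange : ∀ {p q} → IsPath p → IsPath q → pathLength p ≤ 2 → pathLength q ≤ 2 →
             Exchangeable p q → Exchange p q
  exchange {_ ∷ []} _ _ _ _ (() , _)
  exchange {_} {_ ∷ []} _ _ _ _ (_ , () , _)
  exchange {_ ∷ _ ∷ _ ∷ _ ∷ _} _ _ (s≤s (s≤s ())) _ _
  exchange {_} {_ ∷ _ ∷ _ ∷ _ ∷ _} _ _ _ (s≤s (s≤s ())) _
  exchange {_ ∷ _ ∷ []} {_ ∷ _ ∷ []} (xy ∷ [-]) (uw ∷ [-]) _ _ (_ , _ , inj₁ x≡u) =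
    exchange₁₁ xy uw x≡u
  exchange {_ ∷ _ ∷ []} {_ ∷ _ ∷ []} _ _ _ _ (_ , _ , inj₂ (s≤s (s≤s ())))
  exchange {_ ∷ _ ∷ []} {_ ∷ _ ∷ _ ∷ []} (xy ∷ [-]) (uz ∷ zw ∷ [-]) _ _ _ = exchange₁₂ xy uz zw
  exchange {_ ∷ _ ∷ _ ∷ []} {_ ∷ _ ∷ []} (xy ∷ yz ∷ [-]) (uw ∷ [-]) _ _ _ =
    Exchange-sym (exchange₁₂ uw xy yz)
  exchange {_ ∷ _ ∷ _ ∷ []} {_ ∷ _ ∷ _ ∷ []} (xy ∷ yz ∷ [-]) (uv ∷ vw ∷ [-]) _ _ _ =
    exchange₂₂ xy yz uv vw

  exchangeable-pair : ∀ {L} → All (λ p → pathLength p ≤ 2) L → 3 ≤ totalLength L →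
                      ∃₂ λ p q → ∃[ R ] (L ↭ p ∷ q ∷ R × Exchangeable p q)
  exchangeable-pair {L} short total
    with pick (nonempty-path (≤-trans (s≤s z≤n) total))
  ... | p , R , p≥1 , σ
    with pick (nonempty-path (positive-rest (pathLength p) _ (subst (3 ≤_) (totalLength-↭ σ) total)
                                            (s≤s (All.head (All-resp-↭ σ short)))))
  ... | q , R′ , q≥1 , τ
    with side (List⁺.head p) Bool.≟ side (List⁺.head q) | 3 ≤? pathLength p + pathLength q
  ... | yes p≡q | _      = p , q , R′ , ↭-trans σ (↭-prep p τ) , p≥1 , q≥1 , inj₁ p≡q
  ... | no  _   | yes pq = p , q , R′ , ↭-trans σ (↭-prep p τ) , p≥1 , q≥1 , inj₂ pq
  ... | no  p≢q | no ¬pq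
    with pick (nonempty-path (positive-rest (pathLength p + pathLength q) _
                                            (subst (3 ≤_) (totalLength-↭₂ σ τ) total) (≰⇒> ¬pq)))
  ... | r , R″ , r≥1 , ρ
    with side (List⁺.head r) Bool.≟ side (List⁺.head p)
  ... | yes r≡p = p , r , q ∷ R″ ,
    (↭-trans σ (↭-prep p (↭-trans τ (↭-prep q ρ))) ⟨ ↭-trans ⟩ ↭-prep p (↭-swap q r ↭-refl)) ,
    p≥1 , r≥1 , inj₁ (sym r≡p)
  ... | no  r≢p = q , r , p ∷ R″ ,
    (↭-trans σ (↭-prep p (↭-trans τ (↭-prep q ρ))) ⟨ ↭-trans ⟩
     (↭-swap p q ↭-refl ⟨ ↭-trans ⟩ ↭-prep q (↭-swap p r ↭-refl))) ,
    q≥1 , r≥1 , inj₁ (≢∧≢⇒≡ (p≢q ∘ sym) r≢p)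

  module _ {α β : Vertex → Set} {L : Linkage (K m n)} (rs : IsABRigidShortest (K m n) α β L) where

    no-long-path : ¬ Any (λ p → 3 ≤ pathLength p) L
    no-long-path long with pick long
    ... | _ ∷ []               , _ , ()                   , _
    ... | _ ∷ _ ∷ []           , _ , s≤s ()               , _
    ... | _ ∷ _ ∷ _ ∷ []       , _ , s≤s (s≤s ())         , _
    ... | v₀ ∷ v₁ ∷ v₂ ∷ v₃ ∷ rest , R , _ , σ with IsABLinkage-resp-↭ σ (proj₁ rs)
    -- v₀ and v₃ lie on opposite sides, so the path can skip v₁ v₂.
    ... | ((v₀v₁ ∷ v₁v₂ ∷ v₂v₃ ∷ path) ∷ _ , u) , _ =
      no-better-replacement rs {A = (v₀ ∷ v₁ ∷ v₂ ∷ v₃ ∷ rest) ∷ []} {R} {A' = (v₀ ∷ v₃ ∷ rest) ∷ []}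
        σ
        ((Adj-respˡ (sym (Adj₂⇒side≡ v₀v₁ v₁v₂)) v₂v₃ ∷ path) ∷ [])
        (Unique-drop-mid (v₀ ∷ []) (Unique-drop-mid (v₀ ∷ []) u))
        ↭-refl
        (↭-reflexive (cong (_∷ []) (trans (last-skip v₀ [] v₃ rest)
                                          (sym (last-skip v₀ (v₁ ∷ v₂ ∷ []) v₃ rest)))))
        (inj₁ (+-monoˡ-< _ (s≤s (s≤s (s≤s z≤n)))))

    paths-short : All (λ p → pathLength p ≤ 2) L
    paths-short = All.map (≤-pred ∘ ≰⇒>) (AllP.¬Any⇒All¬ L no-long-path)

    totalLength≤2 : totalLength L ≤ 2
    totalLength≤2 with 3 ≤? totalLength L
    ... | no  few  = ≤-pred (≰⇒> few)
    ... | yes many with exchangeable-pair paths-short many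
    ... | p , q , R , σ , ex with IsABLinkage-resp-↭ σ (proj₁ rs) | All-resp-↭ σ paths-short
    ... | ((p-path ∷ q-path ∷ _ , _) , _) | p≤2 ∷ q≤2 ∷ _ =
      ⊥-elim (no-exchange rs σ (exchange p-path q-path p≤2 q≤2 ex))

  size≤order+2 : ∀ {L} → IsRigidShortest (K m n) L → size (K m n) L ≤ order (K m n) L + 2
  size≤order+2 {L} (_ , _ , rs) =
    subst (_≤ length L + 2) (sym (size≡order+totalLength L)) (+-monoʳ-≤ (length L) (totalLength≤2 rs))

  module _ (twin : Vertex → Vertex) (twin-side : ∀ v → side (twin v) ≡ side v)
           (twin-≢ : ∀ v → twin v ≢ v) where

    size≤2-of-order-1 : ∀ {L} → IsRigidShortest (K m n) L → order (K m n) L ≡ 1 → size (K m n) L ≤ 2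
    size≤2-of-order-1 {[]}                             _ ()
    size≤2-of-order-1 {_ ∷ _ ∷ _}                      _ ()
    size≤2-of-order-1 {(_ ∷ []) ∷ []}                  _ _ = s≤s z≤n
    size≤2-of-order-1 {(_ ∷ _ ∷ []) ∷ []}              _ _ = ≤-refl
    size≤2-of-order-1 {(_ ∷ _ ∷ _ ∷ _ ∷ _) ∷ []} rsL _ with size≤order+2 rsL
    ... | s≤s (s≤s (s≤s ()))
    -- x (twin y) z is a second shortest linkage, through the new edge x (twin y).
    size≤2-of-order-1 {L@((x ∷ y ∷ z ∷ []) ∷ [])} (_ , _ , rs) _ with proj₁ rs
    ... | ((xy ∷ yz ∷ [-]) ∷ [] , (_ ∷ x≢z ∷ []) ∷ _) , _ =
      ⊥-elim (no-better-replacement rs {A = L} {[]} {A' = (x ∷ twin y ∷ z ∷ []) ∷ []} ↭-refl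
        ((xy′ ∷ y′z ∷ [-]) ∷ [])
        ((x≢y′ ∷ x≢z ∷ []) ∷ (y′≢z ∷ []) ∷ [] ∷ [])
        ↭-refl ↭-refl
        (inj₂ (refl , x , twin y , here (inj₁ ([] , z ∷ [] , refl)) , fresh)))
      where
      xy′ : KAdj m n x (twin y)
      xy′ = Adj-respʳ (sym (twin-side y)) xy
      y′z : KAdj m n (twin y) z
      y′z = Adj-respˡ (sym (twin-side y)) yz
      x≢y′ : x ≢ twin y
      x≢y′ = side≢⇒≢ (Adj⇒side≢ xy′)
      y′≢z : twin y ≢ z
      y′≢z = side≢⇒≢ (Adj⇒side≢ y′z)
      fresh : ¬ EIn (K m n) L x (twin y)
      fresh e with EIn⇒path e
      ... | _ , here refl , _ , here y′≡x                 = x≢y′ (sym y′≡x)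
      ... | _ , here refl , _ , there (here y′≡y)         = twin-≢ y y′≡y
      ... | _ , here refl , _ , there (there (here y′≡z)) = y′≢z y′≡z

  RSL≡t+2 : ∀ {t L} → IsRigidShortest (K m n) L → order (K m n) L ≡ t → size (K m n) L ≡ t + 2 →
            RSL≡ (K m n) t (t + 2)
  RSL≡t+2 rs order≡ size≡ =
    (_ , rs , order≡ , size≡) ,
    λ L' rs' order'≡ → subst (λ t → size (K m n) L' ≤ t + 2) order'≡ (size≤order+2 rs')

  _≟ᵥ_ : DecidableEquality Vertex
  _≟ᵥ_ = SumP.≡-dec Fin._≟_ Fin._≟_

  -- Vertices not used by the core paths below, which have indices 0 and 1.
  Outer : Vertex → Set
  Outer (inj₁ i) = 2 ≤ toℕ i
  Outer (inj₂ j) = 2 ≤ toℕ j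

  outer-disjoint : ∀ {xs ys} → All (λ v → ¬ Outer v) xs → All Outer ys → Disjoint xs ys
  outer-disjoint inner outer (v∈xs , v∈ys) = All.lookup inner v∈xs (All.lookup outer v∈ys)

  choose-outer : ∀ k {xs} → Unique xs → All Outer xs → k ≤ length xs →
                 ∃[ S ] (Unique S × All Outer S × length S ≡ k)
  choose-outer k {xs} unique outer k≤ =
    take k xs , UniqueP.take⁺ k unique , AllP.take⁺ k outer , trans (length-take k xs) (m≤n⇒m⊓n≡m k≤)

module LargeSides (m′ n′ : ℕ) where

  open Linkages (K (2 + m′) (2 + n′))
  open CompleteBipartite (2 + m′) (2 + n′)

  a₁ a₂ b₁ b₂ : Vertex
  a₁ = inj₁ zero
  a₂ = inj₁ (suc zero)
  b₁ = inj₂ zero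
  b₂ = inj₂ (suc zero)

  edge : Linkage (K (2 + m′) (2 + n′))
  edge = (a₁ ∷ b₁ ∷ []) ∷ []

  edge-rigid : IsRigidShortest (K (2 + m′) (2 + n′)) (edge ++ singletons [])
  edge-rigid = rigid-shortest-with-singletons _≟ᵥ_
    (((tt ∷ [-]) ∷ []) , ((λ ()) ∷ []) ∷ [] ∷ []) [] (outer-disjoint ((λ ()) ∷ (λ ()) ∷ []) [])
    (endpoints-covered endpoint) ((forced ∷ [-]) ∷ [])
    where
    endpoint : ∀ {v} → v ∈ verts (K (2 + m′) (2 + n′)) edge → Heads edge v ⊎ Lasts edge v
    endpoint (here refl)         = inj₁ (here refl)
    endpoint (there (here refl)) = inj₂ (here refl)
    forced : ForcedStep edge a₁ b₁
    forced (here refl)         ()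
    forced (there (here refl)) _ = inj₁ refl

  matching : Linkage (K (2 + m′) (2 + n′))
  matching = (a₁ ∷ b₁ ∷ []) ∷ (b₂ ∷ a₂ ∷ []) ∷ []

  matching-rigid : ∀ {S} → Unique S → All Outer S →
                   IsRigidShortest (K (2 + m′) (2 + n′)) (matching ++ singletons S)
  matching-rigid S-unique S-outer = rigid-shortest-with-singletons _≟ᵥ_
    (((tt ∷ [-]) ∷ (tt ∷ [-]) ∷ []) ,
     ((λ ()) ∷ (λ ()) ∷ (λ ()) ∷ []) ∷ ((λ ()) ∷ (λ ()) ∷ []) ∷ ((λ ()) ∷ []) ∷ [] ∷ [])
    S-unique (outer-disjoint ((λ ()) ∷ (λ ()) ∷ (λ { (s≤s ()) }) ∷ (λ { (s≤s ()) }) ∷ []) S-outer)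
    (endpoints-covered endpoint) ((forced-a₁b₁ ∷ [-]) ∷ (forced-b₂a₂ ∷ [-]) ∷ [])
    where
    endpoint : ∀ {v} → v ∈ verts (K (2 + m′) (2 + n′)) matching → Heads matching v ⊎ Lasts matching v
    endpoint (here refl)                         = inj₁ (here refl)
    endpoint (there (here refl))                 = inj₂ (here refl)
    endpoint (there (there (here refl)))         = inj₁ (there (here refl))
    endpoint (there (there (there (here refl)))) = inj₂ (there (here refl))
    forced-a₁b₁ : ForcedStep matching a₁ b₁
    forced-a₁b₁ (here refl)                         ()
    forced-a₁b₁ (there (here refl))                 _ = inj₁ refl
    forced-a₁b₁ (there (there (here refl)))         _ = inj₂ (there (here refl))
    forced-a₁b₁ (there (there (there (here refl)))) ()
    forced-b₂a₂ : ForcedStep matching b₂ a₂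
    forced-b₂a₂ (here refl)                         _ = inj₂ (here refl)
    forced-b₂a₂ (there (here refl))                 ()
    forced-b₂a₂ (there (there (here refl)))         ()
    forced-b₂a₂ (there (there (there (here refl)))) _ = inj₁ refl

  outer : List Vertex
  outer = map (inj₁ ∘ (2 ↑ʳ_)) (allFin m′) ++ map (inj₂ ∘ (2 ↑ʳ_)) (allFin n′)

  outer-unique : Unique outer
  outer-unique = UniqueP.++⁺ (UniqueP.map⁺ (λ { refl → refl }) (UniqueP.allFin⁺ m′))
                             (UniqueP.map⁺ (λ { refl → refl }) (UniqueP.allFin⁺ n′))
                             halves-disjoint
    where
    halves-disjoint : Disjoint (map (inj₁ ∘ (2 ↑ʳ_)) (allFin m′)) (map (inj₂ ∘ (2 ↑ʳ_)) (allFin n′))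
    halves-disjoint (v∈ˡ , v∈ʳ) with ∈-map⁻ _ v∈ˡ | ∈-map⁻ _ v∈ʳ
    ... | _ , _ , refl | _ , _ , ()

  outer-Outer : All Outer outer
  outer-Outer =
    AllP.++⁺ (AllP.map⁺ {f = inj₁ ∘ (2 ↑ʳ_)} (All.universal (λ _ → s≤s (s≤s z≤n)) (allFin m′)))
             (AllP.map⁺ {f = inj₂ ∘ (2 ↑ʳ_)} (All.universal (λ _ → s≤s (s≤s z≤n)) (allFin n′)))

  outer-length : length outer ≡ m′ + n′
  outer-length = trans (length-++ (map (inj₁ ∘ (2 ↑ʳ_)) (allFin m′)))
    (cong₂ _+_ (trans (length-map _ (allFin m′)) (length-tabulate {n = m′} id))
               (trans (length-map _ (allFin n′)) (length-tabulate {n = n′} id)))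

  twin : Vertex → Vertex
  twin (inj₁ zero)    = a₂
  twin (inj₁ (suc _)) = a₁
  twin (inj₂ zero)    = b₂
  twin (inj₂ (suc _)) = b₁

  twin-side : ∀ v → side (twin v) ≡ side v
  twin-side (inj₁ zero)    = refl
  twin-side (inj₁ (suc _)) = refl
  twin-side (inj₂ zero)    = refl
  twin-side (inj₂ (suc _)) = refl

  twin-≢ : ∀ v → twin v ≢ v
  twin-≢ (inj₁ zero)    ()
  twin-≢ (inj₁ (suc _)) ()
  twin-≢ (inj₂ zero)    ()
  twin-≢ (inj₂ (suc _)) ()

  RSL-edge : RSL≡ (K (2 + m′) (2 + n′)) 1 2
  RSL-edge = (edge ++ singletons [] , edge-rigid , refl , refl) ,
             λ _ rs order≡1 → size≤2-of-order-1 twin twin-side twin-≢ rs order≡1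

  RSL-matching : ∀ k → k ≤ m′ + n′ → RSL≡ (K (2 + m′) (2 + n′)) (2 + k) (2 + k + 2)
  RSL-matching k k≤ =
    let S , S-unique , S-outer , |S|≡k =
          choose-outer k outer-unique outer-Outer (subst (k ≤_) (sym outer-length) k≤)
    in RSL≡t+2 (matching-rigid S-unique S-outer)
               (trans (order-++-singletons matching S) (cong (2 +_) |S|≡k))
               (trans (size-++-singletons matching S)
                      (trans (cong (4 +_) |S|≡k) (cong (2 +_) (+-comm 2 k))))

module SingletonSide (n′ : ℕ) where

  open Linkages (K 1 (2 + n′))
  open CompleteBipartite 1 (2 + n′)

  c b₁ b₂ : Vertex
  c  = inj₁ zero
  b₁ = inj₂ zero
  b₂ = inj₂ (suc zero)

  star : Linkage (K 1 (2 + n′))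
  star = (b₁ ∷ c ∷ b₂ ∷ []) ∷ []

  star-rigid : ∀ {S} → Unique S → All Outer S → IsRigidShortest (K 1 (2 + n′)) (star ++ singletons S)
  star-rigid {S} S-unique S-outer = rigid-shortest-with-singletons _≟ᵥ_
    (((tt ∷ tt ∷ [-]) ∷ []) , ((λ ()) ∷ (λ ()) ∷ []) ∷ ((λ ()) ∷ []) ∷ [] ∷ [])
    S-unique (outer-disjoint ((λ ()) ∷ (λ ()) ∷ (λ { (s≤s ()) }) ∷ []) S-outer)
    covered ((forced-b₁c ∷ forced-cb₂ ∷ [-]) ∷ [])
    where
    L = star ++ singletons S
    b₁-not-last : ¬ Lasts L b₁
    b₁-not-last lasts with AnyP.++⁻ star lasts
    ... | inj₁ (here ())
    ... | inj₁ (there ())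
    ... | inj₂ in-S with All.lookup S-outer (Lasts-singletons in-S)
    ... | ()
    covered : ∀ {L'} → IsABLinkage (K 1 (2 + n′)) (Heads L) (Lasts L) L' →
              verts (K 1 (2 + n′)) star ⊆ verts (K 1 (2 + n′)) L'
    covered ab' (here refl) = α⊆verts ab' (here refl)
    covered ab' (there (here refl)) with α⇒head ab' (here refl)
    ... | _ ∷ []             , r∈ , refl = ⊥-elim (b₁-not-last (last-β ab' r∈))
    ... | _ ∷ inj₁ zero ∷ _  , r∈ , refl = ∈-verts⁺ r∈ (there (here refl))
    ... | _ ∷ inj₂ _ ∷ _     , r∈ , refl with All.lookup (proj₁ (proj₁ ab')) r∈
    ... | () ∷ _
    covered ab' (there (there (here refl))) = β⊆verts ab' (here refl)
    forced-b₁c : ForcedStep star b₁ c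
    forced-b₁c (here refl)                 ()
    forced-b₁c (there (here refl))         _ = inj₁ refl
    forced-b₁c (there (there (here refl))) ()
    forced-cb₂ : ForcedStep star c b₂
    forced-cb₂ (here refl)                 _ = inj₂ (here refl)
    forced-cb₂ (there (here refl))         ()
    forced-cb₂ (there (there (here refl))) _ = inj₁ refl

  outer : List Vertex
  outer = map (inj₂ ∘ (2 ↑ʳ_)) (allFin n′)

  outer-unique : Unique outer
  outer-unique = UniqueP.map⁺ (λ { refl → refl }) (UniqueP.allFin⁺ n′)

  outer-Outer : All Outer outer
  outer-Outer = AllP.map⁺ {f = inj₂ ∘ (2 ↑ʳ_)} (All.universal (λ _ → s≤s (s≤s z≤n)) (allFin n′))

  outer-length : length outer ≡ n′
  outer-length = trans (length-map _ (allFin n′)) (length-tabulate {n = n′} id)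

  RSL-star : ∀ k → k ≤ n′ → RSL≡ (K 1 (2 + n′)) (1 + k) (1 + k + 2)
  RSL-star k k≤ =
    let S , S-unique , S-outer , |S|≡k =
          choose-outer k outer-unique outer-Outer (subst (k ≤_) (sym outer-length) k≤)
    in RSL≡t+2 (star-rigid S-unique S-outer)
               (trans (order-++-singletons star S) (cong suc |S|≡k))
               (trans (size-++-singletons star S)
                      (trans (cong (3 +_) |S|≡k) (cong suc (+-comm 2 k))))

proposition6p3 : (m n : ℕ) → 1 ≤ m → m ≤ n → n ≢ 1 →
    (2 ≤ m → RSL≡ (K m n) 1 2)
    × (1 ≡ m → m < n → RSL≡ (K m n) 1 3)
    × (∀ t → 2 ≤ t → t ≤ m + n ∸ 2 → RSL≡ (K m n) t (t + 2))
proposition6p3 zero           _              ()  _          _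
proposition6p3 1              zero           _   ()         _
proposition6p3 1              1              _   _          n≢1 = ⊥-elim (n≢1 refl)
proposition6p3 1              (suc (suc n′)) _   _          _   =
  (λ { (s≤s ()) }) , (λ _ _ → RSL-star 0 z≤n) , λ { (suc k) _ t≤ → RSL-star k (≤-pred t≤) }
  where open SingletonSide n′
proposition6p3 (suc (suc m′)) zero           _   ()         _
proposition6p3 (suc (suc m′)) (suc zero)     _   (s≤s ())   _
proposition6p3 (suc (suc m′)) (suc (suc n′)) _   _          _   =
  (λ _ → RSL-edge) , (λ ()) ,
  λ { 1 (s≤s ()) _
    ; (suc (suc k)) _ t≤ → RSL-matching k (≤-pred (≤-pred (subst (2 + k ≤_) m′+2+n′ t≤))) }
  where
  open LargeSides m′ n′
  m′+2+n′ : m′ + (2 + n′) ≡ 2 + (m′ + n′)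
  m′+2+n′ = trans (+-suc m′ (suc n′)) (cong suc (+-suc m′ n′))
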